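{- For any $q\in\mathbb{C}$ and $0\le j\le n$, in $\mathcal{H}_n(q)$, $$\mathcal{B}_{j+1}(q)\,\mathcal{B}_{j+2}(q)\cdots\mathcal{B}_n(q)=x_{(j,1^{n-j})}=\sum_{\substack{w\in\mathfrak{S}_n:\\ w^{ -1}(1)<w^{ -1}(2)<\dots<w^{ -1}(j)}}T_w.$$
   Context: $\mathcal{H}_n(q)$ is the Type A Iwahori–Hecke algebra over $\mathbb{C}$ with generators $T_{s_1},\dots,T_{s_{n-1}}$, relations $T_{s_i}^2=(q-1)T_{s_i}+q$, far commutation and braid relations, and basis $T_w$ ($w\in\mathfrak{S}_n$), $T_w=T_{s_{i_1}}\cdots T_{s_{i_\ell}}$ for any reduced word of $w$. $\mathcal{B}_k(q)=\sum_{i=1}^kT_{s_{k-1}}T_{s_{k-2}}\cdots T_{s_i}$ (the $i=k$ term is $1$). $x_{(j,1^{n-j})}$ is the sum of $T_w$ over the minimal-length representatives $w$ of the right cosets $\mathfrak{S}_{(j,1^{n-j})}w$, where $\mathfrak{S}_{(j,1^{n-j})}$ is generated by $s_1,\dots,s_{j-1}$; these representatives are exactly the $w$ with $w^{ -1}(1)<\dots<w^{ -1}(j)$. -}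

module Defs where

open import Level using (Level)
open import Data.Nat using (ℕ; zero; suc; _∸_; _≤_; _<_; _≤?_; _≡ᵇ_; _<ᵇ_)
open import Data.Bool using (Bool; true; false; if_then_else_; _∧_; not)
open import Data.List using (List; []; _∷_; _++_; map; concatMap; filter; foldr; length; upTo)
open import Relation.Nullary using (does)
open import Algebra.Bundles using (Ring)

-- Permutations of {1,…,n} in one-line notation, stored 0-based:
-- the list [w(1)-1, …, w(n)-1].  Composition is of functions, so
-- w · s_i (right multiplication) swaps the entries at positions i, i+1.

words : ℕ → ℕ → List (List ℕ)
words n zero    = [] ∷ []
words n (suc k) = concatMap (λ v → map (v ∷_) (words n k)) (upTo n)

elem : ℕ → List ℕ → Bool
elem v []       = false
elem v (x ∷ xs) = (v ≡ᵇ x) Data.Bool.∨ elem v xs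

nodup : List ℕ → Bool
nodup []       = true
nodup (x ∷ xs) = not (elem x xs) ∧ nodup xs

perms : ℕ → List (List ℕ)
perms n = filter (λ w → nodup w Data.Bool.≟ true) (words n n)

-- 0-based position of value v in w  (= w^{-1}(v+1) - 1)
pos : ℕ → List ℕ → ℕ
pos v []       = zero
pos v (x ∷ xs) = if v ≡ᵇ x then zero else suc (pos v xs)

allB : (ℕ → Bool) → List ℕ → Bool
allB p = foldr (λ x b → p x ∧ b) true

minRep : ℕ → List ℕ → Bool
minRep j w = allB (λ i → pos i w <ᵇ pos (suc i) w) (upTo (j ∸ 1))

remove : ℕ → List ℕ → List ℕ
remove v []       = []
remove v (x ∷ xs) = if v ≡ᵇ x then xs else x ∷ remove v xs

desc : ℕ → ℕ → List ℕ
desc t zero    = []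
desc t (suc c) = t ∷ desc (t ∸ 1) c

-- A reduced word (list of 1-based generator indices i, meaning s_i) for a
-- permutation of {0,…,m-1} given in one-line notation: if the maximum m-1
-- sits at 0-based position p, then w = w' · s_{m-1} s_{m-2} ⋯ s_{p+1}
-- with w' obtained by moving m-1 to the end, and lengths add.
-- First argument is fuel = length of the list.
redWord' : ℕ → List ℕ → List ℕ
redWord' zero    w = []
redWord' (suc k) w = redWord' k (remove k w) ++ desc k (k ∸ pos k w)

redWord : List ℕ → List ℕ
redWord w = redWord' (length w) w

-- Elements of a ring A equipped with T : ℕ → A (T i playing T_{s_i}).

module HeckeNotation {c ℓ : Level} (A : Ring c ℓ) (T : ℕ → Ring.Carrier A) where
  open Ring A

  prodT : List ℕ → Carrier
  prodT = foldr (λ i a → T i * a) 1#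

  Tw : List ℕ → Carrier
  Tw w = prodT (redWord w)

  sumA : List Carrier → Carrier
  sumA = foldr _+_ 0#

  -- B_k = Σ_{i=1}^{k} T_{s_{k-1}} T_{s_{k-2}} ⋯ T_{s_i}   (i = k term is 1)
  B : ℕ → Carrier
  B k = sumA (map (λ c → prodT (desc (k ∸ 1) c)) (upTo k))

  BB : ℕ → ℕ → Carrier
  BB j zero    = 1#
  BB j (suc m) = if does (j ≤? m) then BB j m * B (suc m) else 1#

  xλ : ℕ → ℕ → Carrier
  xλ j n = sumA (map Tw (filter (λ w → minRep j w Data.Bool.≟ true) (perms n)))

record HeckeRelations {c ℓ : Level} (A : Ring c ℓ) (n : ℕ)
                      (q : Ring.Carrier A) (T : ℕ → Ring.Carrier A) : Set (c Level.⊔ ℓ) where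
  open Ring A
  field
    quadratic : ∀ i → 1 ≤ i → i < n →
                T i * T i ≈ (q + - 1#) * T i + q
    farComm   : ∀ i k → 1 ≤ i → i < n → 1 ≤ k → k < n → suc i < k →
                T i * T k ≈ T k * T i
    braid     : ∀ i → 1 ≤ i → suc i < n →
                T i * (T (suc i) * T i) ≈ T (suc i) * (T i * T (suc i))
    qCentral  : ∀ i → 1 ≤ i → i < n → q * T i ≈ T i * q

-- Every w ∈ S_{m+1} arises from a unique v ∈ S_m by inserting the letter m+1 into its one-line
-- notation, say with c letters after it, and the reduced word chosen for w is that of v followed by
-- s_m s_{m-1} ⋯ s_{m-c+1}. Hence T_w = T_v T_{s_m} ⋯ T_{s_{m-c+1}}, and as c ranges over 0, …, m
-- these second factors are exactly the summands of B_{m+1}. For j ≤ m the insertion does not change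
-- the relative positions of 1, …, j, so w is a minimal coset representative iff v is, and summing gives
-- x_{(j,1^{m+1-j})} = x_{(j,1^{m-j})} B_{m+1}. The induction starts at n = j, where the identity is the
-- only representative and x_{(j)} = T_id = 1.

module Submission where

open import Defs
open import Level using (Level)
open import Algebra.Bundles using (Ring; Semiring)
open import Data.Bool using (Bool; true; false; if_then_else_; _∧_)
open import Data.Bool.Properties using (T-≡) renaming (_≟_ to _≟ᵇ_)
open import Function.Bundles using (Equivalence)
open import Data.Empty using (⊥-elim)
open import Data.Nat using (ℕ; zero; suc; _∸_; _≤_; _<_; _≤?_; _<?_; _≡ᵇ_; _<ᵇ_; z≤n; s≤s; s≤s⁻¹)
open import Data.Nat.Properties
  using ( _≟_; <⇒≢; <-trans; n<1+n; <-≤-trans; m∸n≤m; m∸[m∸n]≡n; m≤n⇒m<n∨m≡n; m≤n⇒m≤1+n; <⇒≱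
        ; suc-injective; <-irrefl; m<n⇒m<1+n; <ᵇ⇒<; ≤-antisym; ≤-refl; <⇒≤)
open import Data.List
  using ( List; []; _∷_; _++_; [_]; map; concatMap; filter; foldr; length; upTo
        ; cartesianProductWith; cartesianProduct)
open import Data.List.Properties
  using ( map-++; map-∘; map-cong-local; filter-++; filter-all; filter-none; length-upTo; upTo-∷ʳ; map-upTo
        ; ++-identityʳ)
open import Data.List.Membership.Propositional using (_∈_; _∉_)
open import Data.List.Membership.Propositional.Properties
open import Data.List.Membership.Propositional.Properties.WithK using (unique∧set⇒bag)
open import Data.List.Membership.DecPropositional _≟_ using (_∈?_)
open import Data.List.Relation.Unary.Any using (here; there)
open import Data.List.Relation.Unary.All as All using (All; []; _∷_)
open import Data.List.Relation.Unary.All.Properties using (¬Any⇒All¬; All¬⇒¬Any; map⁺)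
open import Data.List.Relation.Unary.Unique.Propositional using (Unique; []; _∷_)
import Data.List.Relation.Unary.Unique.Propositional.Properties as Unique
open import Data.List.Relation.Binary.Permutation.Propositional
  using (_↭_; ↭-refl; ↭-prep; ↭-swap; ↭-trans; ↭-sym; ↭⇒↭ₛ; ↭⇒↭ₛ′)
open import Data.List.Relation.Binary.Permutation.Propositional.Properties
  using (All-resp-↭; ↭-length; filter-↭) renaming (map⁺ to ↭-map⁺)
import Data.List.Relation.Binary.Permutation.Setoid.Properties as SetoidPermutation
open import Data.List.Relation.Binary.BagAndSetEquality using (∼bag⇒↭)
open import Data.Product using (_×_; _,_; proj₁; proj₂)
open import Data.Sum using (inj₁; inj₂)
open import Function using (_∘_; case_of_; _⇔_; mk⇔)
open import Relation.Nullary using (yes; no)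
open import Relation.Unary using (Decidable)
open import Relation.Nullary.Decidable using (dec-true; dec-false)
open import Relation.Binary.PropositionalEquality
  using (_≡_; _≢_; refl; sym; trans; cong; cong₂; subst; module ≡-Reasoning)
import Relation.Binary.PropositionalEquality as ≡

Unique-resp-↭ : ∀ {A : Set} {xs ys : List A} → xs ↭ ys → Unique xs → Unique ys
Unique-resp-↭ {A} p = SetoidPermutation.Unique-resp-↭ (≡.setoid A) (↭⇒↭ₛ p)

unique∧sameElements⇒↭ : ∀ {A : Set} {xs ys : List A} → Unique xs → Unique ys →
  (∀ {z} → z ∈ xs → z ∈ ys) → (∀ {z} → z ∈ ys → z ∈ xs) → xs ↭ ys
unique∧sameElements⇒↭ uxs uys to from = ∼bag⇒↭ (unique∧set⇒bag uxs uys (mk⇔ to from))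

map-cartesianProductWith-retraction : ∀ {A B C : Set} (f : A → B → C) (r : C → A × B) xs ys →
  (∀ {a b} → a ∈ xs → b ∈ ys → r (f a b) ≡ (a , b)) →
  map r (cartesianProductWith f xs ys) ≡ cartesianProduct xs ys
map-cartesianProductWith-retraction f r [] ys _ = refl
map-cartesianProductWith-retraction f r (x ∷ xs) ys retract = begin
  map r (map (f x) ys ++ cartesianProductWith f xs ys)
    ≡⟨ map-++ r (map (f x) ys) _ ⟩
  map r (map (f x) ys) ++ map r (cartesianProductWith f xs ys)
    ≡⟨ cong₂ _++_ (trans (sym (map-∘ ys)) (map-cong-local (All.tabulate (retract (here refl)))))
                  (map-cartesianProductWith-retraction f r xs ys (retract ∘ there)) ⟩
  map (x ,_) ys ++ cartesianProduct xs ys ∎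
  where open ≡-Reasoning

Unique-cartesianProductWith-retraction : ∀ {A B C : Set} (f : A → B → C) (r : C → A × B) {xs ys} →
  (∀ {a b} → a ∈ xs → b ∈ ys → r (f a b) ≡ (a , b)) →
  Unique xs → Unique ys → Unique (cartesianProductWith f xs ys)
Unique-cartesianProductWith-retraction f r {xs} {ys} retract uxs uys =
  Unique.map⁻ (subst Unique (sym (map-cartesianProductWith-retraction f r xs ys retract))
                            (Unique.cartesianProduct⁺ uxs uys))

filter-cartesianProductWith : ∀ {A B C : Set} {P : C → Set} {Q : A → Set}
  (P? : Decidable P) (Q? : Decidable Q) (f : A → B → C) → (∀ a b → P (f a b) ⇔ Q a) → ∀ xs ys →
  filter P? (cartesianProductWith f xs ys) ≡ cartesianProductWith f (filter Q? xs) ys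
filter-cartesianProductWith P? Q? f P⇔Q []       ys = refl
filter-cartesianProductWith P? Q? f P⇔Q (x ∷ xs) ys
  rewrite filter-++ P? (map (f x) ys) (cartesianProductWith f xs ys)
        | filter-cartesianProductWith P? Q? f P⇔Q xs ys
  with Q? x
... | yes qx = cong (_++ cartesianProductWith f (filter Q? xs) ys)
  (filter-all P? (map⁺ (All.universal (λ y → Equivalence.from (P⇔Q x y) qx) ys)))
... | no ¬qx = cong (_++ cartesianProductWith f (filter Q? xs) ys)
  (filter-none P? (map⁺ (All.universal (λ y → ¬qx ∘ Equivalence.to (P⇔Q x y)) ys)))

insertAt : ∀ {A : Set} → ℕ → A → List A → List A
insertAt zero    x v       = x ∷ v
insertAt (suc p) x []      = x ∷ []
insertAt (suc p) x (y ∷ v) = y ∷ insertAt p x v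

insertAt-↭ : ∀ {A : Set} p (x : A) v → insertAt p x v ↭ x ∷ v
insertAt-↭ zero    x v       = ↭-refl
insertAt-↭ (suc p) x []      = ↭-refl
insertAt-↭ (suc p) x (y ∷ v) = ↭-trans (↭-prep y (insertAt-↭ p x v)) (↭-swap y x ↭-refl)

length-insertAt : ∀ {A : Set} p (x : A) v → length (insertAt p x v) ≡ suc (length v)
length-insertAt p x v = ↭-length (insertAt-↭ p x v)

insertAt-length : ∀ {A : Set} (x : A) v → insertAt (length v) x v ≡ v ++ [ x ]
insertAt-length x []      = refl
insertAt-length x (y ∷ v) = cong (y ∷_) (insertAt-length x v)

Unique-insertAt⁺ : ∀ {A : Set} p (x : A) v → x ∉ v → Unique v → Unique (insertAt p x v)
Unique-insertAt⁺ p x v x∉v uv = Unique-resp-↭ (↭-sym (insertAt-↭ p x v)) (¬Any⇒All¬ v x∉v ∷ uv)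

Unique-insertAt⁻ : ∀ {A : Set} p (x : A) v → Unique (insertAt p x v) → x ∉ v × Unique v
Unique-insertAt⁻ p x v u with Unique-resp-↭ (insertAt-↭ p x v) u
... | x∉v ∷ uv = All¬⇒¬Any x∉v , uv

All-insertAt⁺ : ∀ {A : Set} {P : A → Set} p x v → P x → All P v → All P (insertAt p x v)
All-insertAt⁺ p x v px pv = All-resp-↭ (↭-sym (insertAt-↭ p x v)) (px ∷ pv)

All-insertAt⁻ : ∀ {A : Set} {P : A → Set} p x v → All P (insertAt p x v) → P x × All P v
All-insertAt⁻ p x v a with All-resp-↭ (insertAt-↭ p x v) a
... | px ∷ pv = px , pv

module SemiringSums {c ℓ : Level} (R : Semiring c ℓ) where
  open Semiring R renaming (refl to ≈-refl; sym to ≈-sym; trans to ≈-trans)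
  open import Relation.Binary.Reasoning.Setoid setoid

  ∑ : ∀ {X : Set} → List X → (X → Carrier) → Carrier
  ∑ xs f = foldr _+_ 0# (map f xs)

  infix 5 ∑
  syntax ∑ xs (λ x → e) = ∑[ x ∈ xs ] e

  ∑-↭ : ∀ {X : Set} {xs ys : List X} (f : X → Carrier) → xs ↭ ys → ∑ xs f ≈ ∑ ys f
  ∑-↭ f p =
    SetoidPermutation.foldr-commMonoid setoid +-isCommutativeMonoid (↭⇒↭ₛ′ isEquivalence (↭-map⁺ f p))

  ∑-cong : ∀ {X : Set} xs {f g : X → Carrier} → (∀ {x} → x ∈ xs → f x ≈ g x) → ∑ xs f ≈ ∑ xs g
  ∑-cong []       _  = ≈-refl
  ∑-cong (x ∷ xs) eq = +-cong (eq (here refl)) (∑-cong xs (eq ∘ there))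

  ∑-++ : ∀ {X : Set} xs ys (f : X → Carrier) → ∑ (xs ++ ys) f ≈ ∑ xs f + ∑ ys f
  ∑-++ []       ys f = ≈-sym (+-identityˡ _)
  ∑-++ (x ∷ xs) ys f = ≈-trans (+-congˡ (∑-++ xs ys f)) (≈-sym (+-assoc _ _ _))

  ∑-cartesianProductWith : ∀ {X Y Z : Set} (g : X → Y → Z) xs ys (f : Z → Carrier) →
    ∑ (cartesianProductWith g xs ys) f ≈ ∑[ x ∈ xs ] ∑[ y ∈ ys ] f (g x y)
  ∑-cartesianProductWith g []       ys f = ≈-refl
  ∑-cartesianProductWith g (x ∷ xs) ys f = begin
    ∑ (map (g x) ys ++ cartesianProductWith g xs ys) f
      ≈⟨ ∑-++ (map (g x) ys) _ f ⟩
    ∑ (map (g x) ys) f + ∑ (cartesianProductWith g xs ys) f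
      ≈⟨ +-cong (reflexive (cong (foldr _+_ 0#) (sym (map-∘ ys)))) (∑-cartesianProductWith g xs ys f) ⟩
    (∑[ y ∈ ys ] f (g x y)) + (∑[ x ∈ xs ] ∑[ y ∈ ys ] f (g x y)) ∎

  *-distribˡ-∑ : ∀ {X : Set} a xs (f : X → Carrier) → a * ∑ xs f ≈ ∑[ x ∈ xs ] a * f x
  *-distribˡ-∑ a []       f = zeroʳ a
  *-distribˡ-∑ a (x ∷ xs) f = ≈-trans (distribˡ a _ _) (+-congˡ (*-distribˡ-∑ a xs f))

  *-distribʳ-∑ : ∀ {X : Set} a xs (f : X → Carrier) → ∑ xs f * a ≈ ∑[ x ∈ xs ] f x * a
  *-distribʳ-∑ a []       f = zeroˡ a
  *-distribʳ-∑ a (x ∷ xs) f = ≈-trans (distribʳ a _ _) (+-congˡ (*-distribʳ-∑ a xs f))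

≡ᵇ-refl : ∀ x → (x ≡ᵇ x) ≡ true
≡ᵇ-refl x = dec-true (x ≟ x) refl

≢⇒≡ᵇ-false : ∀ {x y} → x ≢ y → (x ≡ᵇ y) ≡ false
≢⇒≡ᵇ-false {x} {y} = dec-false (x ≟ y)

m<n∸1⇒1+m<n : ∀ {m} n → m < n ∸ 1 → suc m < n
m<n∸1⇒1+m<n (suc n) m<n = s≤s m<n

allB-cong : ∀ (f g : ℕ → Bool) xs → (∀ {i} → i ∈ xs → f i ≡ g i) → allB f xs ≡ allB g xs
allB-cong f g []       _  = refl
allB-cong f g (x ∷ xs) eq = cong₂ _∧_ (eq (here refl)) (allB-cong f g xs (eq ∘ there))

allB≡true⁺ : ∀ (f : ℕ → Bool) xs → (∀ {i} → i ∈ xs → f i ≡ true) → allB f xs ≡ true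
allB≡true⁺ f []       _  = refl
allB≡true⁺ f (x ∷ xs) fs rewrite fs (here refl) = allB≡true⁺ f xs (fs ∘ there)

allB≡true⁻ : ∀ (f : ℕ → Bool) xs → allB f xs ≡ true → ∀ {i} → i ∈ xs → f i ≡ true
allB≡true⁻ f (x ∷ xs) e i∈ with f x in fx | i∈
... | true | here refl = fx
... | true | there i∈′ = allB≡true⁻ f xs e i∈′

remove-insertAt : ∀ p x v → x ∉ v → remove x (insertAt p x v) ≡ v
remove-insertAt zero    x v       _   rewrite ≡ᵇ-refl x = refl
remove-insertAt (suc p) x []      _   rewrite ≡ᵇ-refl x = refl
remove-insertAt (suc p) x (y ∷ v) x∉ rewrite ≢⇒≡ᵇ-false (x∉ ∘ here) =
  cong (y ∷_) (remove-insertAt p x v (x∉ ∘ there))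

pos-insertAt : ∀ p x v → x ∉ v → p ≤ length v → pos x (insertAt p x v) ≡ p
pos-insertAt zero    x v       _  _       rewrite ≡ᵇ-refl x = refl
pos-insertAt (suc p) x (y ∷ v) x∉ (s≤s p≤) rewrite ≢⇒≡ᵇ-false (x∉ ∘ here) =
  cong suc (pos-insertAt p x v (x∉ ∘ there) p≤)

insertAt-pos-remove : ∀ x w → x ∈ w → insertAt (pos x w) x (remove x w) ≡ w
insertAt-pos-remove x (y ∷ w) x∈ with x ≟ y
... | yes refl rewrite ≡ᵇ-refl x = refl
... | no x≢y rewrite ≢⇒≡ᵇ-false x≢y with x∈
...   | here x≡y = ⊥-elim (x≢y x≡y)
...   | there x∈w = cong (y ∷_) (insertAt-pos-remove x w x∈w)

pos<length : ∀ x w → x ∈ w → pos x w < length w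
pos<length x (y ∷ w) x∈ with x ≟ y
... | yes refl rewrite ≡ᵇ-refl x = s≤s z≤n
... | no x≢y rewrite ≢⇒≡ᵇ-false x≢y with x∈
...   | here x≡y = ⊥-elim (x≢y x≡y)
...   | there x∈w = s≤s (pos<length x w x∈w)

module _ {x : ℕ} {w : List ℕ} (x∈w : x ∈ w) where

  private
    split : w ≡ insertAt (pos x w) x (remove x w)
    split = sym (insertAt-pos-remove x w x∈w)

  length-remove : length w ≡ suc (length (remove x w))
  length-remove = trans (cong length split) (length-insertAt (pos x w) x (remove x w))

  Unique-remove : Unique w → x ∉ remove x w × Unique (remove x w)
  Unique-remove uw = Unique-insertAt⁻ (pos x w) x (remove x w) (subst Unique split uw)

  All-remove : ∀ {P : ℕ → Set} → All P w → All P (remove x w)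
  All-remove aw = proj₂ (All-insertAt⁻ (pos x w) x (remove x w) (subst (All _) split aw))

pos-insertAt-<ᵇ : ∀ p x v a b → a ≢ x → b ≢ x →
  (pos a (insertAt p x v) <ᵇ pos b (insertAt p x v)) ≡ (pos a v <ᵇ pos b v)
pos-insertAt-<ᵇ zero    x v       a b a≢x b≢x rewrite ≢⇒≡ᵇ-false a≢x | ≢⇒≡ᵇ-false b≢x = refl
pos-insertAt-<ᵇ (suc p) x []      a b a≢x b≢x rewrite ≢⇒≡ᵇ-false a≢x | ≢⇒≡ᵇ-false b≢x = refl
pos-insertAt-<ᵇ (suc p) x (y ∷ v) a b a≢x b≢x with a ≡ᵇ y | b ≡ᵇ y
... | true  | true  = refl
... | true  | false = refl
... | false | true  = refl
... | false | false = pos-insertAt-<ᵇ p x v a b a≢x b≢x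

pos-map-suc : ∀ i xs → pos (suc i) (map suc xs) ≡ pos i xs
pos-map-suc i []       = refl
pos-map-suc i (x ∷ xs) = cong (λ r → if i ≡ᵇ x then 0 else suc r) (pos-map-suc i xs)

pos-upTo : ∀ m i → i < m → pos i (upTo m) ≡ i
pos-upTo (suc m) zero    _         = refl
pos-upTo (suc m) (suc i) (s≤s i<m) rewrite sym (map-upTo suc m) =
  cong suc (trans (pos-map-suc i (upTo m)) (pos-upTo m i i<m))

minRep? : ∀ j → Decidable (λ w → minRep j w ≡ true)
minRep? j w = minRep j w ≟ᵇ true

minRep-insertAt : ∀ j m p v → j ≤ m → minRep j (insertAt p m v) ≡ minRep j v
minRep-insertAt j m p v j≤m = allB-cong _ _ (upTo (j ∸ 1)) λ i∈ →
  let 1+i<m = <-≤-trans (m<n∸1⇒1+m<n j (∈-upTo⁻ i∈)) j≤m in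
  pos-insertAt-<ᵇ p m v _ _ (<⇒≢ (<-trans (n<1+n _) 1+i<m)) (<⇒≢ 1+i<m)

minRep-remove : ∀ j m w → j ≤ m → m ∈ w → minRep j (remove m w) ≡ minRep j w
minRep-remove j m w j≤m m∈w =
  trans (sym (minRep-insertAt j m (pos m w) (remove m w) j≤m))
        (cong (minRep j) (insertAt-pos-remove m w m∈w))

minRep-suc⇒minRep : ∀ m w → minRep (suc m) w ≡ true → minRep m w ≡ true
minRep-suc⇒minRep m w mr = allB≡true⁺ _ (upTo (m ∸ 1)) λ i∈ →
  allB≡true⁻ _ (upTo m) mr (∈-upTo⁺ (<-≤-trans (∈-upTo⁻ i∈) (m∸n≤m m 1)))

minRep-upTo : ∀ m → minRep m (upTo m) ≡ true
minRep-upTo m = allB≡true⁺ _ (upTo (m ∸ 1)) λ {i} i∈ →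
  let 1+i<m = m<n∸1⇒1+m<n m (∈-upTo⁻ i∈) in
  trans (cong₂ _<ᵇ_ (pos-upTo m i (<-trans (n<1+n i) 1+i<m)) (pos-upTo m (suc i) 1+i<m))
        (dec-true (i <? suc i) (n<1+n i))

minRep⇒≤pos : ∀ m w → minRep (suc m) w ≡ true → ∀ i → i ≤ m → i ≤ pos i w
minRep⇒≤pos m w mr zero    _   = z≤n
minRep⇒≤pos m w mr (suc i) i<m =
  <-≤-trans (s≤s (minRep⇒≤pos m w mr i (<⇒≤ i<m)))
    (<ᵇ⇒< _ _ (Equivalence.from T-≡ (allB≡true⁻ _ (upTo m) mr (∈-upTo⁺ i<m))))

redWord-insertAt : ∀ m p v → length v ≡ m → m ∉ v → p ≤ m →
  redWord (insertAt p m v) ≡ redWord v ++ desc m (m ∸ p)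
redWord-insertAt m p v refl m∉v p≤m
  rewrite length-insertAt p m v | remove-insertAt p m v m∉v | pos-insertAt p m v m∉v p≤m = refl

words-suc : ∀ n k → words n (suc k) ≡ cartesianProductWith _∷_ (upTo n) (words n k)
words-suc n k = go (upTo n)
  where
    go : ∀ xs → concatMap (λ v → map (v ∷_) (words n k)) xs ≡ cartesianProductWith _∷_ xs (words n k)
    go []       = refl
    go (x ∷ xs) = cong (map (x ∷_) (words n k) ++_) (go xs)

∈-words⁻ : ∀ n k {w} → w ∈ words n k → length w ≡ k × All (_< n) w
∈-words⁻ n zero    (here refl) = refl , []
∈-words⁻ n (suc k) w∈ rewrite words-suc n k
  with _ , _ , x∈ , v∈ , refl ← ∈-cartesianProductWith⁻ _∷_ (upTo n) (words n k) w∈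
  with lv , av ← ∈-words⁻ n k v∈ = cong suc lv , ∈-upTo⁻ x∈ ∷ av

∈-words⁺ : ∀ n k {w} → length w ≡ k → All (_< n) w → w ∈ words n k
∈-words⁺ n zero    {[]}    _  _        = here refl
∈-words⁺ n (suc k) {x ∷ w} lw (x<n ∷ aw) rewrite words-suc n k =
  ∈-cartesianProductWith⁺ _∷_ (∈-upTo⁺ x<n) (∈-words⁺ n k (suc-injective lw) aw)

Unique-words : ∀ n k → Unique (words n k)
Unique-words n zero    = [] ∷ []
Unique-words n (suc k) rewrite words-suc n k =
  Unique.cartesianProductWith⁺ _∷_ ∷-injective (Unique.upTo⁺ n) (Unique-words n k)
  where
    ∷-injective : ∀ {x y : ℕ} {v w} → x ∷ v ≡ y ∷ w → x ≡ y × v ≡ w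
    ∷-injective refl = refl , refl

∉⇒elem≡false : ∀ x xs → x ∉ xs → elem x xs ≡ false
∉⇒elem≡false x []       _  = refl
∉⇒elem≡false x (y ∷ xs) x∉ rewrite ≢⇒≡ᵇ-false (x∉ ∘ here) = ∉⇒elem≡false x xs (x∉ ∘ there)

elem≡false⇒∉ : ∀ x xs → elem x xs ≡ false → x ∉ xs
elem≡false⇒∉ x (y ∷ xs) e x∈ with x ≟ y | x∈
... | yes refl | _         rewrite ≡ᵇ-refl x = case e of λ ()
... | no x≢y   | here x≡y  = x≢y x≡y
... | no x≢y   | there x∈′ rewrite ≢⇒≡ᵇ-false x≢y = elem≡false⇒∉ x xs e x∈′

Unique⇒nodup : ∀ w → Unique w → nodup w ≡ true
Unique⇒nodup []       _          = refl
Unique⇒nodup (x ∷ xs) (x∉ ∷ uxs) rewrite ∉⇒elem≡false x xs (All¬⇒¬Any x∉) = Unique⇒nodup xs uxs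

nodup⇒Unique : ∀ w → nodup w ≡ true → Unique w
nodup⇒Unique []       _ = []
nodup⇒Unique (x ∷ xs) e with elem x xs in ex
... | false = ¬Any⇒All¬ xs (elem≡false⇒∉ x xs ex) ∷ nodup⇒Unique xs e

nodup? : Decidable (λ w → nodup w ≡ true)
nodup? w = nodup w ≟ᵇ true

IsPerm : ℕ → List ℕ → Set
IsPerm n w = length w ≡ n × All (_< n) w × Unique w

∈-perms⁻ : ∀ n {w} → w ∈ perms n → IsPerm n w
∈-perms⁻ n {w} w∈ with w∈words , nd ← ∈-filter⁻ nodup? w∈ =
  let lw , aw = ∈-words⁻ n n w∈words in lw , aw , nodup⇒Unique w nd

∈-perms⁺ : ∀ n {w} → IsPerm n w → w ∈ perms n
∈-perms⁺ n {w} (lw , aw , uw) =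
  ∈-filter⁺ nodup? (∈-words⁺ n n lw aw) (Unique⇒nodup w uw)

Unique-perms : ∀ n → Unique (perms n)
Unique-perms n = Unique.filter⁺ nodup? (Unique-words n n)

All<-tighten : ∀ k w → All (_< suc k) w → k ∉ w → All (_< k) w
All<-tighten k []      _          _  = []
All<-tighten k (x ∷ w) (x<1+k ∷ a) k∉ with m≤n⇒m<n∨m≡n (s≤s⁻¹ x<1+k)
... | inj₁ x<k  = x<k ∷ All<-tighten k w a (k∉ ∘ there)
... | inj₂ refl = ⊥-elim (k∉ (here refl))

length≤-Unique-bounded : ∀ k w → Unique w → All (_< k) w → length w ≤ k
length≤-Unique-bounded zero    []      _  _        = z≤n
length≤-Unique-bounded zero    (x ∷ w) _  (() ∷ _)
length≤-Unique-bounded (suc k) w       uw aw with k ∈? w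
... | no k∉w = m≤n⇒m≤1+n (length≤-Unique-bounded k w uw (All<-tighten k w aw k∉w))
... | yes k∈w with k∉v , uv ← Unique-remove k∈w uw =
  subst (_≤ suc k) (sym (length-remove k∈w))
    (s≤s (length≤-Unique-bounded k (remove k w) uv (All<-tighten k _ (All-remove k∈w aw) k∉v)))

max∈perm : ∀ m {w} → IsPerm (suc m) w → m ∈ w
max∈perm m {w} (lw , aw , uw) with m ∈? w
... | yes m∈w = m∈w
... | no m∉w  = ⊥-elim (<⇒≱ (subst (m <_) (sym lw) (n<1+n m))
                              (length≤-Unique-bounded m w uw (All<-tighten m w aw m∉w)))

IsPerm⇒∉ : ∀ m {v} → IsPerm m v → m ∉ v
IsPerm⇒∉ m (_ , av , _) m∈v = <-irrefl refl (All.lookup av m∈v)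

IsPerm-remove : ∀ m {w} → IsPerm (suc m) w → IsPerm m (remove m w)
IsPerm-remove m {w} pw@(lw , aw , uw)
  with m∈w ← max∈perm m pw
  with m∉v , uv ← Unique-remove m∈w uw =
  suc-injective (trans (sym (length-remove m∈w)) lw) , All<-tighten m _ (All-remove m∈w aw) m∉v , uv

pos-max≤ : ∀ m {w} → IsPerm (suc m) w → pos m w ≤ m
pos-max≤ m {w} pw@(lw , _ , _) = s≤s⁻¹ (subst (pos m w <_) lw (pos<length m w (max∈perm m pw)))

IsPerm-insertAt : ∀ m p {v} → IsPerm m v → IsPerm (suc m) (insertAt p m v)
IsPerm-insertAt m p {v} pv@(lv , av , uv) =
  trans (length-insertAt p m v) (cong suc lv) ,
  All-insertAt⁺ p m v (n<1+n m) (All.map m<n⇒m<1+n av) ,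
  Unique-insertAt⁺ p m v (IsPerm⇒∉ m pv) uv

IsPerm-upTo : ∀ m → IsPerm m (upTo m)
IsPerm-upTo m = length-upTo m , All.tabulate ∈-upTo⁻ , Unique.upTo⁺ m

-- In one-line notation (values 0, …, m), insertMax m v c places the new maximum m so that c
-- entries follow it.
insertMax : ℕ → List ℕ → ℕ → List ℕ
insertMax m v c = insertAt (m ∸ c) m v

module _ (m : ℕ) {v : List ℕ} {c : ℕ} (pv : IsPerm m v) (c≤m : c ≤ m) where

  private
    m∉v : m ∉ v
    m∉v = IsPerm⇒∉ m pv
    m∸c≤length : m ∸ c ≤ length v
    m∸c≤length = subst (m ∸ c ≤_) (sym (proj₁ pv)) (m∸n≤m m c)

  remove-insertMax : remove m (insertMax m v c) ≡ v
  remove-insertMax = remove-insertAt (m ∸ c) m v m∉v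

  pos-insertMax : m ∸ pos m (insertMax m v c) ≡ c
  pos-insertMax = trans (cong (m ∸_) (pos-insertAt (m ∸ c) m v m∉v m∸c≤length)) (m∸[m∸n]≡n c≤m)

  redWord-insertMax : redWord (insertMax m v c) ≡ redWord v ++ desc m c
  redWord-insertMax = trans (redWord-insertAt m (m ∸ c) v (proj₁ pv) m∉v (m∸n≤m m c))
                            (cong (λ k → redWord v ++ desc m k) (m∸[m∸n]≡n c≤m))

perms-suc-↭ : ∀ m → perms (suc m) ↭ cartesianProductWith (insertMax m) (perms m) (upTo (suc m))
perms-suc-↭ m = unique∧sameElements⇒↭ (Unique-perms (suc m)) unique-insertions decompose compose
  where
    insertions : List (List ℕ)
    insertions = cartesianProductWith (insertMax m) (perms m) (upTo (suc m))

    retract : ∀ {v c} → v ∈ perms m → c ∈ upTo (suc m) →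
              (remove m (insertMax m v c) , m ∸ pos m (insertMax m v c)) ≡ (v , c)
    retract v∈ c∈ = let pv = ∈-perms⁻ m v∈ ; c≤m = s≤s⁻¹ (∈-upTo⁻ c∈) in
      cong₂ _,_ (remove-insertMax m pv c≤m) (pos-insertMax m pv c≤m)

    unique-insertions : Unique insertions
    unique-insertions = Unique-cartesianProductWith-retraction (insertMax m)
      (λ w → remove m w , m ∸ pos m w) retract (Unique-perms m) (Unique.upTo⁺ (suc m))

    decompose : ∀ {w} → w ∈ perms (suc m) → w ∈ insertions
    decompose {w} w∈ = subst (_∈ insertions) w≡
      (∈-cartesianProductWith⁺ (insertMax m) (∈-perms⁺ m (IsPerm-remove m pw))
                                             (∈-upTo⁺ (s≤s (m∸n≤m m (pos m w)))))
      where
        pw : IsPerm (suc m) w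
        pw = ∈-perms⁻ (suc m) w∈
        w≡ : insertMax m (remove m w) (m ∸ pos m w) ≡ w
        w≡ = trans (cong (λ p → insertAt p m (remove m w)) (m∸[m∸n]≡n (pos-max≤ m pw)))
                   (insertAt-pos-remove m w (max∈perm m pw))

    compose : ∀ {w} → w ∈ insertions → w ∈ perms (suc m)
    compose w∈
      with _ , _ , v∈ , _ , refl ← ∈-cartesianProductWith⁻ (insertMax m) (perms m) (upTo (suc m)) w∈ =
      ∈-perms⁺ (suc m) (IsPerm-insertAt m _ (∈-perms⁻ m v∈))

upTo-suc-insertMax : ∀ m → upTo (suc m) ≡ insertMax m (upTo m) 0
upTo-suc-insertMax m = begin
  upTo (suc m)                        ≡⟨ upTo-∷ʳ m ⟨
  upTo m ++ [ m ]                     ≡⟨ insertAt-length m (upTo m) ⟨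
  insertAt (length (upTo m)) m (upTo m) ≡⟨ cong (λ p → insertAt p m (upTo m)) (length-upTo m) ⟩
  insertMax m (upTo m) 0 ∎
  where open ≡-Reasoning

redWord-upTo : ∀ m → redWord (upTo m) ≡ []
redWord-upTo zero    = refl
redWord-upTo (suc m) = begin
  redWord (upTo (suc m))           ≡⟨ cong redWord (upTo-suc-insertMax m) ⟩
  redWord (insertMax m (upTo m) 0) ≡⟨ redWord-insertMax m (IsPerm-upTo m) z≤n ⟩
  redWord (upTo m) ++ []           ≡⟨ ++-identityʳ (redWord (upTo m)) ⟩
  redWord (upTo m)                 ≡⟨ redWord-upTo m ⟩
  [] ∎
  where open ≡-Reasoning

minRep-perm⇒upTo : ∀ m {w} → IsPerm m w → minRep m w ≡ true → w ≡ upTo m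
minRep-perm⇒upTo zero    {[]} _  _  = refl
minRep-perm⇒upTo (suc m) {w}  pw mr = begin
  w                                  ≡⟨ insertAt-pos-remove m w (max∈perm m pw) ⟨
  insertAt (pos m w) m (remove m w)  ≡⟨ cong₂ (λ p v → insertAt p m v) pos≡m remove≡upTo ⟩
  insertAt m m (upTo m)              ≡⟨ upTo-suc-insertMax m ⟨
  upTo (suc m) ∎
  where
    open ≡-Reasoning
    pos≡m : pos m w ≡ m
    pos≡m = ≤-antisym (pos-max≤ m pw) (minRep⇒≤pos m w mr m ≤-refl)
    remove≡upTo : remove m w ≡ upTo m
    remove≡upTo = minRep-perm⇒upTo m (IsPerm-remove m pw)
      (trans (minRep-remove m m w ≤-refl (max∈perm m pw)) (minRep-suc⇒minRep m w mr))

filter-minRep-perms-↭ : ∀ m → filter (minRep? m) (perms m) ↭ [ upTo m ]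
filter-minRep-perms-↭ m = unique∧sameElements⇒↭ (Unique.filter⁺ P? (Unique-perms m)) ([] ∷ []) only identity
  where
    P? : Decidable (λ w → minRep m w ≡ true)
    P? = minRep? m
    only : ∀ {w} → w ∈ filter P? (perms m) → w ∈ [ upTo m ]
    only w∈ with w∈perms , mr ← ∈-filter⁻ P? w∈ = here (minRep-perm⇒upTo m (∈-perms⁻ m w∈perms) mr)
    identity : ∀ {w} → w ∈ [ upTo m ] → w ∈ filter P? (perms m)
    identity (here refl) = ∈-filter⁺ P? (∈-perms⁺ m (IsPerm-upTo m)) (minRep-upTo m)

module HeckeSums {c ℓ : Level} (A : Ring c ℓ) (T : ℕ → Ring.Carrier A) where
  open Ring A hiding (zero) renaming (refl to ≈-refl; sym to ≈-sym; trans to ≈-trans)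
  open HeckeNotation A T
  open SemiringSums semiring
  open import Relation.Binary.Reasoning.Setoid setoid

  prodT-++ : ∀ xs ys → prodT (xs ++ ys) ≈ prodT xs * prodT ys
  prodT-++ []       ys = ≈-sym (*-identityˡ _)
  prodT-++ (x ∷ xs) ys = ≈-trans (*-congˡ (prodT-++ xs ys)) (≈-sym (*-assoc _ _ _))

  Tw-insertMax : ∀ m {v c} → IsPerm m v → c ≤ m → Tw (insertMax m v c) ≈ Tw v * prodT (desc m c)
  Tw-insertMax m {v} {c} pv c≤m = begin
    prodT (redWord (insertMax m v c))   ≡⟨ cong prodT (redWord-insertMax m pv c≤m) ⟩
    prodT (redWord v ++ desc m c)       ≈⟨ prodT-++ (redWord v) (desc m c) ⟩
    Tw v * prodT (desc m c) ∎

  xλ-suc : ∀ j m → j ≤ m → xλ j (suc m) ≈ xλ j m * B (suc m)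
  xλ-suc j m j≤m = begin
    ∑ (filter P? (perms (suc m))) Tw
      ≈⟨ ∑-↭ Tw (filter-↭ P? (perms-suc-↭ m)) ⟩
    ∑ (filter P? (cartesianProductWith (insertMax m) (perms m) U)) Tw
      ≡⟨ cong (λ ws → ∑ ws Tw) filter-insertions ⟩
    ∑ (cartesianProductWith (insertMax m) V U) Tw
      ≈⟨ ∑-cartesianProductWith (insertMax m) V U Tw ⟩
    ∑[ v ∈ V ] ∑[ c ∈ U ] Tw (insertMax m v c)
      ≈⟨ ∑-cong V (λ v∈ → ∑-cong U (λ c∈ → Tw-insertMax m (IsPerm-V v∈) (s≤s⁻¹ (∈-upTo⁻ c∈)))) ⟩
    ∑[ v ∈ V ] ∑[ c ∈ U ] Tw v * prodT (desc m c)
      ≈⟨ ∑-cong V (λ {v} _ → *-distribˡ-∑ (Tw v) U (prodT ∘ desc m)) ⟨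
    ∑[ v ∈ V ] Tw v * B (suc m)
      ≈⟨ *-distribʳ-∑ (B (suc m)) V Tw ⟨
    xλ j m * B (suc m) ∎
    where
      P? : Decidable (λ w → minRep j w ≡ true)
      P? = minRep? j
      U : List ℕ
      U = upTo (suc m)
      V : List (List ℕ)
      V = filter P? (perms m)
      IsPerm-V : ∀ {v} → v ∈ V → IsPerm m v
      IsPerm-V v∈ = ∈-perms⁻ m (proj₁ (∈-filter⁻ P? v∈))
      filter-insertions : filter P? (cartesianProductWith (insertMax m) (perms m) U)
                        ≡ cartesianProductWith (insertMax m) V U
      filter-insertions = filter-cartesianProductWith P? P? (insertMax m)
        (λ v c → let eq = minRep-insertAt j m (m ∸ c) v j≤m in mk⇔ (trans (sym eq)) (trans eq)) (perms m) U

  xλ-diag : ∀ m → xλ m m ≈ 1#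
  xλ-diag m = begin
    ∑ (filter (minRep? m) (perms m)) Tw ≈⟨ ∑-↭ Tw (filter-minRep-perms-↭ m) ⟩
    Tw (upTo m) + 0#                    ≈⟨ +-identityʳ _ ⟩
    prodT (redWord (upTo m))            ≡⟨ cong prodT (redWord-upTo m) ⟩
    1# ∎

  BB-suc : ∀ j m → j ≤ m → BB j (suc m) ≡ BB j m * B (suc m)
  BB-suc j m j≤m rewrite dec-true (j ≤? m) j≤m = refl

  BB-diag : ∀ n → BB n n ≡ 1#
  BB-diag zero    = refl
  BB-diag (suc m) rewrite dec-false (suc m ≤? m) (<-irrefl refl) = refl

  BB≈xλ : ∀ n j → j ≤ n → BB j n ≈ xλ j n
  BB≈xλ n j j≤n with m≤n⇒m<n∨m≡n j≤n
  BB≈xλ n       j _ | inj₂ refl = ≈-trans (reflexive (BB-diag n)) (≈-sym (xλ-diag n))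
  BB≈xλ (suc m) j _ | inj₁ (s≤s j≤m) = begin
    BB j (suc m)       ≡⟨ BB-suc j m j≤m ⟩
    BB j m * B (suc m) ≈⟨ *-congʳ (BB≈xλ m j j≤m) ⟩
    xλ j m * B (suc m) ≈⟨ xλ-suc j m j≤m ⟨
    xλ j (suc m) ∎

lemma3p12 : ∀ {c ℓ : Level} (A : Ring c ℓ) (n : ℕ) (q : Ring.Carrier A) (T : ℕ → Ring.Carrier A) →
    HeckeRelations A n q T → (j : ℕ) → j ≤ n →
    Ring._≈_ A (HeckeNotation.BB A T j n) (HeckeNotation.xλ A T j n)
lemma3p12 A n _ T _ j j≤n = HeckeSums.BB≈xλ A T n j j≤n
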